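{- Let $p$ and $q$ be odd primes and $m$ a natural number such that $\gcd(m,2pq)=1$, $r_2(p)=r_2(q)$ and $$\gcd\!\left(\frac{p-1}{r_2(p)},\mathrm{ord}_2(m)\right)=\gcd\!\left(\frac{q-1}{r_2(q)},\mathrm{ord}_2(m)\right).$$ Then $i_2(pm)=i_2(qm)$.
   Context: For odd $d\ge1$, $\mathrm{ord}_2(d)$ is the least $r\ge1$ with $2^r\equiv1\pmod d$, $r_2(d)=\varphi(d)/\mathrm{ord}_2(d)$, and $i_2(d)=\sum_{\delta\mid d}\varphi(\delta)/\mathrm{ord}_2(\delta)$. -}

module Defs where

open import Data.Nat using (ℕ; zero; suc; _+_; _*_; _∸_; _^_; _≟_)
open import Data.Nat.Divisibility using (_∣_; _∣?_)
open import Data.Nat.DivMod using (_/_)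
open import Data.Nat.GCD using (gcd)
open import Data.List using (List; []; _∷_; filter; map; length)
open import Data.Nat.ListAction using (sum)
open import Relation.Nullary using (Dec; yes; no)

range1 : ℕ → List ℕ
range1 zero = []
range1 (suc n) = range1 n Data.List.++ (suc n ∷ [])

φ : ℕ → ℕ
φ n = length (filter (λ k → gcd k n ≟ 1) (range1 n))

search : ℕ → ℕ → ℕ → ℕ
search d lo zero = 0
search d lo (suc fuel) with d ∣? (2 ^ lo ∸ 1)
... | yes _ = lo
... | no  _ = search d (suc lo) fuel

-- multiplicative order of 2 modulo d: least r ≥ 1 with 2^r ≡ 1 (mod d).
-- For odd d ≥ 1 it exists and satisfies r ≤ φ(d) ≤ d, so searching r ∈ {1..d}
-- is exhaustive; the fallback value 0 never occurs for odd d ≥ 1.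
ord₂ : ℕ → ℕ
ord₂ d = search d 1 d

_÷_ : ℕ → ℕ → ℕ
a ÷ zero = 0
a ÷ suc b = a / suc b

r₂ : ℕ → ℕ
r₂ d = φ d ÷ ord₂ d

divisors : ℕ → List ℕ
divisors d = filter (λ δ → δ ∣? d) (range1 d)

i₂ : ℕ → ℕ
i₂ d = sum (map (λ δ → φ δ ÷ ord₂ δ) (divisors d))

-- Since p ∤ m, the divisors of p m are the divisors j of m together with their multiples p j.
-- For j ∣ m, φ (p j) = (p - 1) φ j and ord₂ (p j) = lcm (ord₂ p) (ord₂ j); by Fermat's little
-- theorem ord₂ p ∣ p - 1, so p - 1 = r₂ p · ord₂ p and
--   r₂ (p j) = r₂ p · φ j · gcd (ord₂ p) (ord₂ j) / ord₂ j.
-- As ord₂ j ∣ ord₂ m, the gcd equals gcd (gcd (ord₂ p) (ord₂ m)) (ord₂ j).  Hence i₂ (p m)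
-- depends on p only through r₂ p and gcd (ord₂ p) (ord₂ m), where ord₂ p = (p - 1) / r₂ p.
module Submission where

open import Algebra.Properties.CommutativeSemigroup using (interchange; xy∙z≈xz∙y)
open import Data.Empty using (⊥-elim)
open import Data.Fin using (toℕ; fromℕ<)
open import Data.Fin.Properties using (pigeonhole; toℕ<n; toℕ-fromℕ<)
open import Data.List using (List; []; _∷_; _++_; filter; map; length)
open import Data.List.Properties using (map-++)
open import Data.Nat
open import Data.Nat.Combinatorics using (_C_; nCn≡1; nC1≡n; k>n⇒nCk≡0; nCk+nC[k+1]≡[n+1]C[k+1])
open import Data.Nat.Coprimality as Coprime
  using (Coprime; coprime-divisor; prime⇒coprime; coprime-+; coprime⇒gcd≡1; gcd≡1⇒coprime)
open import Data.Nat.Divisibility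
open import Data.Nat.DivMod
  using (_/_; _%_; m≡m%n+[m/n]*n; m%n<n; m/n*n≡m; m*n/n≡m; m*n/m*o≡n/o; /-congˡ; /-congʳ)
open import Data.Nat.GCD using (gcd; gcd-assoc; gcd[m,n]∣n; gcd-greatest)
open import Data.Nat.LCM using (lcm; gcd*lcm; lcm-least; m∣lcm[m,n]; n∣lcm[m,n])
open import Data.Nat.ListAction using (sum)
open import Data.Nat.ListAction.Properties using (sum-++)
open import Data.Nat.Primality using (Prime; prime[2]; prime⇒irreducible; prime⇒nonZero; prime⇒nonTrivial)
open import Data.Nat.Properties
open import Data.Nat.Tactic.RingSolver using (solve-∀)
open import Data.Product using (_×_; _,_; ∃-syntax; proj₁; proj₂; map₁)
open import Data.Sum using (inj₁; inj₂)
open import Function.Base using (_∘_)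
open import Relation.Binary.PropositionalEquality
open import Relation.Nullary

open import Defs

-- Indicators and finite sums

𝟙[_] : ∀ {a} {A : Set a} → Dec A → ℕ
𝟙[ yes _ ] = 1
𝟙[ no  _ ] = 0

𝟙-yes : ∀ {a} {A : Set a} (A? : Dec A) → A → 𝟙[ A? ] ≡ 1
𝟙-yes (yes _) _ = refl
𝟙-yes (no ¬a) a = ⊥-elim (¬a a)

𝟙-no : ∀ {a} {A : Set a} (A? : Dec A) → ¬ A → 𝟙[ A? ] ≡ 0
𝟙-no (yes a) ¬a = ⊥-elim (¬a a)
𝟙-no (no _)  _  = refl

𝟙-cong : ∀ {a b} {A : Set a} {B : Set b} → (A → B) → (B → A) →
         (A? : Dec A) (B? : Dec B) → 𝟙[ A? ] ≡ 𝟙[ B? ]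
𝟙-cong to from (yes a) B? = sym (𝟙-yes B? (to a))
𝟙-cong to from (no ¬a) B? = sym (𝟙-no B? (¬a ∘ from))

∑₁ : ℕ → (ℕ → ℕ) → ℕ
∑₁ zero    f = 0
∑₁ (suc n) f = ∑₁ n f + f (suc n)

infix 2 ∑₁
syntax ∑₁ n (λ k → e) = ∑[1≤ k ≤ n ] e

∑₁-cong : ∀ n {f g} → (∀ {k} → 1 ≤ k → k ≤ n → f k ≡ g k) → ∑₁ n f ≡ ∑₁ n g
∑₁-cong zero    f≗g = refl
∑₁-cong (suc n) f≗g =
  cong₂ _+_ (∑₁-cong n (λ 1≤k k≤n → f≗g 1≤k (m≤n⇒m≤1+n k≤n))) (f≗g (s≤s z≤n) ≤-refl)

∑₁-zero : ∀ n {f} → (∀ {k} → 1 ≤ k → k ≤ n → f k ≡ 0) → ∑₁ n f ≡ 0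
∑₁-zero zero    f≗0 = refl
∑₁-zero (suc n) f≗0 =
  cong₂ _+_ (∑₁-zero n (λ 1≤k k≤n → f≗0 1≤k (m≤n⇒m≤1+n k≤n))) (f≗0 (s≤s z≤n) ≤-refl)

∑₁-distrib-+ : ∀ n f g → (∑[1≤ k ≤ n ] f k + g k) ≡ ∑₁ n f + ∑₁ n g
∑₁-distrib-+ zero    f g = refl
∑₁-distrib-+ (suc n) f g = begin
  (∑[1≤ k ≤ n ] f k + g k) + (f (suc n) + g (suc n))
    ≡⟨ cong (_+ (f (suc n) + g (suc n))) (∑₁-distrib-+ n f g) ⟩
  (∑₁ n f + ∑₁ n g) + (f (suc n) + g (suc n))
    ≡⟨ interchange +-commutativeSemigroup (∑₁ n f) _ _ _ ⟩
  (∑₁ n f + f (suc n)) + (∑₁ n g + g (suc n))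
    ∎
  where open ≡-Reasoning

∑₁-split : ∀ m n f → ∑₁ (m + n) f ≡ ∑₁ m f + (∑[1≤ k ≤ n ] f (m + k))
∑₁-split m zero    f = trans (cong (λ l → ∑₁ l f) (+-identityʳ m)) (sym (+-identityʳ _))
∑₁-split m (suc n) f = begin
  ∑₁ (m + suc n) f
    ≡⟨ cong (λ l → ∑₁ l f) (+-suc m n) ⟩
  ∑₁ (m + n) f + f (suc (m + n))
    ≡⟨ cong₂ _+_ (∑₁-split m n f) (cong f (sym (+-suc m n))) ⟩
  ∑₁ m f + (∑[1≤ k ≤ n ] f (m + k)) + f (m + suc n)
    ≡⟨ +-assoc (∑₁ m f) _ _ ⟩
  ∑₁ m f + (∑[1≤ k ≤ suc n ] f (m + k))
    ∎
  where open ≡-Reasoning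

∑₁-suc : ∀ n (f : ℕ → ℕ) → ∑₁ (suc n) f ≡ f 1 + (∑[1≤ k ≤ n ] f (suc k))
∑₁-suc zero    f = +-comm 0 (f 1)
∑₁-suc (suc n) f = trans (cong (_+ f (2 + n)) (∑₁-suc n f)) (+-assoc (f 1) _ _)

∑₁-tail : ∀ {m n} f → m ≤ n → (∀ {k} → m < k → f k ≡ 0) → ∑₁ n f ≡ ∑₁ m f
∑₁-tail {m} {n} f m≤n f≗0 = begin
  ∑₁ n f                                 ≡⟨ cong (λ l → ∑₁ l f) (m+[n∸m]≡n m≤n) ⟨
  ∑₁ (m + (n ∸ m)) f                     ≡⟨ ∑₁-split m (n ∸ m) f ⟩
  ∑₁ m f + (∑[1≤ k ≤ n ∸ m ] f (m + k))  ≡⟨ cong (∑₁ m f +_) (∑₁-zero (n ∸ m) (λ 1≤k _ → f≗0 (m<m+n m 1≤k))) ⟩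
  ∑₁ m f + 0                             ≡⟨ +-identityʳ _ ⟩
  ∑₁ m f                                 ∎
  where open ≡-Reasoning

∑₁-periodic : ∀ e f → (∀ k → f (e + k) ≡ f k) → ∀ a → ∑₁ (a * e) f ≡ a * ∑₁ e f
∑₁-periodic e f periodic zero    = refl
∑₁-periodic e f periodic (suc a) = begin
  ∑₁ (e + a * e) f                       ≡⟨ ∑₁-split e (a * e) f ⟩
  ∑₁ e f + (∑[1≤ k ≤ a * e ] f (e + k))  ≡⟨ cong (∑₁ e f +_) (∑₁-cong (a * e) (λ _ _ → periodic _)) ⟩
  ∑₁ e f + ∑₁ (a * e) f                  ≡⟨ cong (∑₁ e f +_) (∑₁-periodic e f periodic a) ⟩
  ∑₁ e f + a * ∑₁ e f                    ∎
  where open ≡-Reasoning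

∑₁-multiples : ∀ p .{{_ : NonZero p}} (f : ℕ → ℕ) N →
               (∑[1≤ k ≤ p * N ] 𝟙[ p ∣? k ] * f k) ≡ (∑[1≤ j ≤ N ] f (p * j))
∑₁-multiples p f zero rewrite *-zeroʳ p = refl
∑₁-multiples p@(suc p′) f (suc N) = begin
  ∑₁ (p * suc N) g                             ≡⟨ cong (λ l → ∑₁ l g) p*[1+N]≡p*N+p ⟩
  ∑₁ (p * N + p) g                             ≡⟨ ∑₁-split (p * N) p g ⟩
  ∑₁ (p * N) g + (∑[1≤ k ≤ p ] g (p * N + k))  ≡⟨ cong₂ _+_ (∑₁-multiples p f N) lastBlock ⟩
  (∑[1≤ j ≤ N ] f (p * j)) + f (p * suc N)     ∎
  where
  open ≡-Reasoning
  g : ℕ → ℕ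
  g k = 𝟙[ p ∣? k ] * f k
  p*[1+N]≡p*N+p : p * suc N ≡ p * N + p
  p*[1+N]≡p*N+p = trans (*-suc p N) (+-comm p (p * N))
  g-vanishes : ∀ {k} → 1 ≤ k → k ≤ p′ → g (p * N + k) ≡ 0
  g-vanishes {k} 1≤k k≤p′ = cong (_* f (p * N + k)) (𝟙-no (p ∣? p * N + k)
    (λ p∣pN+k → >⇒∤ {{>-nonZero 1≤k}} (s≤s k≤p′) (∣m+n∣m⇒∣n p∣pN+k (m∣m*n N))))
  g[pN+p] : g (p * N + p) ≡ f (p * suc N)
  g[pN+p] = begin
    𝟙[ p ∣? p * N + p ] * f (p * N + p)  ≡⟨ cong (_* f (p * N + p)) (𝟙-yes (p ∣? _) p∣p*N+p) ⟩
    1 * f (p * N + p)                    ≡⟨ *-identityˡ _ ⟩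
    f (p * N + p)                        ≡⟨ cong f p*[1+N]≡p*N+p ⟨
    f (p * suc N)                        ∎
    where
    p∣p*N+p : p ∣ p * N + p
    p∣p*N+p = ∣m∣n⇒∣m+n (m∣m*n N) ∣-refl
  lastBlock : (∑[1≤ k ≤ p ] g (p * N + k)) ≡ f (p * suc N)
  lastBlock = cong₂ _+_ (∑₁-zero p′ g-vanishes) g[pN+p]

∣-∑₁ : ∀ {d} n {f : ℕ → ℕ} → (∀ {k} → 1 ≤ k → k ≤ n → d ∣ f k) → d ∣ ∑₁ n f
∣-∑₁ zero    d∣f = _ ∣0
∣-∑₁ (suc n) d∣f =
  ∣m∣n⇒∣m+n (∣-∑₁ n (λ 1≤k k≤n → d∣f 1≤k (m≤n⇒m≤1+n k≤n))) (d∣f (s≤s z≤n) ≤-refl)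

sum-map-range1 : ∀ (f : ℕ → ℕ) n → sum (map f (range1 n)) ≡ ∑₁ n f
sum-map-range1 f zero    = refl
sum-map-range1 f (suc n) = begin
  sum (map f (range1 n ++ suc n ∷ []))      ≡⟨ cong sum (map-++ f (range1 n) (suc n ∷ [])) ⟩
  sum (map f (range1 n) ++ f (suc n) ∷ [])  ≡⟨ sum-++ (map f (range1 n)) (f (suc n) ∷ []) ⟩
  sum (map f (range1 n)) + (f (suc n) + 0)  ≡⟨ cong₂ _+_ (sum-map-range1 f n) (+-identityʳ _) ⟩
  ∑₁ n f + f (suc n)                        ∎
  where open ≡-Reasoning

sum-map-filter : ∀ {p} {P : ℕ → Set p} (P? : ∀ x → Dec (P x)) (f : ℕ → ℕ) xs →
                 sum (map f (filter P? xs)) ≡ sum (map (λ x → 𝟙[ P? x ] * f x) xs)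
sum-map-filter P? f []       = refl
sum-map-filter P? f (x ∷ xs) with P? x
... | yes _ = cong₂ _+_ (sym (+-identityʳ (f x))) (sum-map-filter P? f xs)
... | no  _ = sum-map-filter P? f xs

length≡sum-map-const1 : ∀ (xs : List ℕ) → length xs ≡ sum (map (λ _ → 1) xs)
length≡sum-map-const1 []       = refl
length≡sum-map-const1 (x ∷ xs) = cong suc (length≡sum-map-const1 xs)

sum-map-divisors : ∀ (f : ℕ → ℕ) n →
                   sum (map f (divisors n)) ≡ (∑[1≤ k ≤ n ] 𝟙[ k ∣? n ] * f k)
sum-map-divisors f n = trans (sum-map-filter (_∣? n) f (range1 n)) (sum-map-range1 _ n)

sum-map-divisors-cong : ∀ n {f g} → (∀ {k} → k ∣ n → f k ≡ g k) →
                        sum (map f (divisors n)) ≡ sum (map g (divisors n))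
sum-map-divisors-cong n {f} {g} f≗g = begin
  sum (map f (divisors n))            ≡⟨ sum-map-divisors f n ⟩
  (∑[1≤ k ≤ n ] 𝟙[ k ∣? n ] * f k)    ≡⟨ ∑₁-cong n (λ {k} _ _ → onDivisors k) ⟩
  (∑[1≤ k ≤ n ] 𝟙[ k ∣? n ] * g k)    ≡⟨ sum-map-divisors g n ⟨
  sum (map g (divisors n))            ∎
  where
  open ≡-Reasoning
  onDivisors : ∀ k → 𝟙[ k ∣? n ] * f k ≡ 𝟙[ k ∣? n ] * g k
  onDivisors k with k ∣? n
  ... | yes k∣n = cong (_+ 0) (f≗g k∣n)
  ... | no  _   = refl

prime∤⇒coprime : ∀ {p k} → Prime p → ¬ p ∣ k → Coprime p k
prime∤⇒coprime p-prime p∤k (i∣p , i∣k) with prime⇒irreducible p-prime i∣p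
... | inj₁ i≡1  = i≡1
... | inj₂ refl = ⊥-elim (p∤k i∣k)

coprime-∣ˡ : ∀ {a b c} → Coprime a b → c ∣ a → Coprime c b
coprime-∣ˡ a⊥b c∣a (i∣c , i∣b) = a⊥b (∣-trans i∣c c∣a , i∣b)

coprime-∣ʳ : ∀ {a b c} → Coprime a b → c ∣ b → Coprime a c
coprime-∣ʳ a⊥b c∣b = Coprime.sym (coprime-∣ˡ (Coprime.sym a⊥b) c∣b)

coprime-*ʳ : ∀ {a b c} → Coprime a b → Coprime a c → Coprime a (b * c)
coprime-*ʳ a⊥b a⊥c (i∣a , i∣bc) = a⊥c (i∣a , coprime-divisor (coprime-∣ˡ a⊥b i∣a) i∣bc)

coprime-*ˡ : ∀ {a b c} → Coprime a c → Coprime b c → Coprime (a * b) c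
coprime-*ˡ a⊥c b⊥c = Coprime.sym (coprime-*ʳ (Coprime.sym a⊥c) (Coprime.sym b⊥c))

coprime-+⁻¹ : ∀ {m n} → Coprime (n + m) n → Coprime m n
coprime-+⁻¹ n+m⊥n (i∣m , i∣n) = n+m⊥n (∣m∣n⇒∣m+n i∣n i∣m , i∣n)

coprime-^ʳ : ∀ {d n} a → Coprime d n → Coprime d (n ^ a)
coprime-^ʳ zero    d⊥n (_ , i∣1) = ∣1⇒≡1 i∣1
coprime-^ʳ (suc a) d⊥n = coprime-*ʳ d⊥n (coprime-^ʳ a d⊥n)

∣×∣⇒*∣ : ∀ {a b n} → Coprime a b → a ∣ n → b ∣ n → a * b ∣ n
∣×∣⇒*∣ {a} {b} a⊥b (divides q refl) b∣qa = subst (a * b ∣_) (*-comm a q)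
  (*-monoʳ-∣ a (coprime-divisor (Coprime.sym a⊥b) (subst (b ∣_) (*-comm q a) b∣qa)))

divisor-nonZero : ∀ {j m} .{{_ : NonZero m}} → j ∣ m → NonZero j
divisor-nonZero {zero}  {m} 0∣m = ⊥-elim (≢-nonZero⁻¹ m (0∣⇒≡0 0∣m))
divisor-nonZero {suc j}     _   = _

𝟙-coprime-cong : ∀ {k n k′ n′} → (Coprime k n → Coprime k′ n′) → (Coprime k′ n′ → Coprime k n) →
                 𝟙[ gcd k n ≟ 1 ] ≡ 𝟙[ gcd k′ n′ ≟ 1 ]
𝟙-coprime-cong to from =
  𝟙-cong (coprime⇒gcd≡1 ∘ to ∘ gcd≡1⇒coprime) (coprime⇒gcd≡1 ∘ from ∘ gcd≡1⇒coprime) _ _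

-- Euler's totient

φ-as-∑ : ∀ n → φ n ≡ (∑[1≤ k ≤ n ] 𝟙[ gcd k n ≟ 1 ])
φ-as-∑ n = begin
  length (filter coprime? (range1 n))               ≡⟨ length≡sum-map-const1 (filter coprime? (range1 n)) ⟩
  sum (map (λ _ → 1) (filter coprime? (range1 n)))  ≡⟨ sum-map-filter coprime? _ (range1 n) ⟩
  sum (map (λ k → 𝟙[ coprime? k ] * 1) (range1 n))  ≡⟨ sum-map-range1 _ n ⟩
  (∑[1≤ k ≤ n ] 𝟙[ coprime? k ] * 1)                ≡⟨ ∑₁-cong n (λ _ _ → *-identityʳ _) ⟩
  (∑[1≤ k ≤ n ] 𝟙[ coprime? k ])                    ∎
  where
  open ≡-Reasoning
  coprime? : ∀ k → Dec (gcd k n ≡ 1)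
  coprime? k = gcd k n ≟ 1

module _ {p e} (p-prime : Prime p) (p⊥e : Coprime p e) where

  private
    [_⊥_] : ℕ → ℕ → ℕ
    [ k ⊥ n ] = 𝟙[ gcd k n ≟ 1 ]

    ⊥e-periodic : ∀ k → [ e + k ⊥ e ] ≡ [ k ⊥ e ]
    ⊥e-periodic k = 𝟙-coprime-cong {e + k} {e} {k} {e} coprime-+⁻¹ coprime-+

    ⊥e-*p : ∀ k → [ p * k ⊥ e ] ≡ [ k ⊥ e ]
    ⊥e-*p k = 𝟙-coprime-cong {p * k} {e} {k} {e}
      (λ pk⊥e → coprime-∣ˡ pk⊥e (n∣m*n p))
      (coprime-*ˡ p⊥e)

    ⊥e-split : ∀ k → [ k ⊥ e ] ≡ [ k ⊥ p * e ] + 𝟙[ p ∣? k ] * [ k ⊥ e ]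
    ⊥e-split k with p ∣? k
    ... | yes p∣k = sym (cong₂ _+_ (𝟙-no (gcd k (p * e) ≟ 1) ¬k⊥pe) (*-identityˡ _))
      where
      ¬k⊥pe : gcd k (p * e) ≢ 1
      ¬k⊥pe k⊥pe = <⇒≢ (nonTrivial⇒n>1 p {{prime⇒nonTrivial p-prime}})
                       (sym (gcd≡1⇒coprime k⊥pe (p∣k , m∣m*n e)))
    ... | no  p∤k = sym (trans (+-identityʳ _) (𝟙-coprime-cong {k} {p * e} {k} {e}
                      (λ k⊥pe → coprime-∣ʳ k⊥pe (n∣m*n p))
                      (coprime-*ʳ (Coprime.sym (prime∤⇒coprime p-prime p∤k)))))

    φe-as-multiples : φ e ≡ (∑[1≤ k ≤ p * e ] 𝟙[ p ∣? k ] * [ k ⊥ e ])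
    φe-as-multiples = begin
      φ e                                         ≡⟨ φ-as-∑ e ⟩
      ∑₁ e [_⊥ e ]                                ≡⟨ ∑₁-cong e (λ _ _ → ⊥e-*p _) ⟨
      (∑[1≤ j ≤ e ] [ p * j ⊥ e ])                ≡⟨ ∑₁-multiples p {{prime⇒nonZero p-prime}} [_⊥ e ] e ⟨
      (∑[1≤ k ≤ p * e ] 𝟙[ p ∣? k ] * [ k ⊥ e ])  ∎
      where open ≡-Reasoning

  φ[p*e]+φ[e]≡p*φ[e] : φ (p * e) + φ e ≡ p * φ e
  φ[p*e]+φ[e]≡p*φ[e] = begin
    φ (p * e) + φ e
      ≡⟨ cong₂ _+_ (φ-as-∑ (p * e)) φe-as-multiples ⟩
    ∑₁ (p * e) [_⊥ p * e ] + (∑[1≤ k ≤ p * e ] 𝟙[ p ∣? k ] * [ k ⊥ e ])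
      ≡⟨ ∑₁-distrib-+ (p * e) _ _ ⟨
    (∑[1≤ k ≤ p * e ] [ k ⊥ p * e ] + 𝟙[ p ∣? k ] * [ k ⊥ e ])
      ≡⟨ ∑₁-cong (p * e) (λ _ _ → ⊥e-split _) ⟨
    ∑₁ (p * e) [_⊥ e ]
      ≡⟨ ∑₁-periodic e [_⊥ e ] ⊥e-periodic p ⟩
    p * ∑₁ e [_⊥ e ]
      ≡⟨ cong (p *_) (φ-as-∑ e) ⟨
    p * φ e
      ∎
    where open ≡-Reasoning

  φ-*-prime : φ (p * e) ≡ (p ∸ 1) * φ e
  φ-*-prime = begin
    φ (p * e)              ≡⟨ m+n∸n≡m (φ (p * e)) (φ e) ⟨
    φ (p * e) + φ e ∸ φ e  ≡⟨ cong₂ _∸_ φ[p*e]+φ[e]≡p*φ[e] (sym (*-identityˡ (φ e))) ⟩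
    p * φ e ∸ 1 * φ e      ≡⟨ *-distribʳ-∸ (φ e) p 1 ⟨
    (p ∸ 1) * φ e          ∎
    where open ≡-Reasoning

φ-prime : ∀ {p} → Prime p → φ p ≡ p ∸ 1
φ-prime {p} p-prime = begin
  φ p              ≡⟨ cong φ (*-identityʳ p) ⟨
  φ (p * 1)        ≡⟨ φ-*-prime p-prime (λ (_ , i∣1) → ∣1⇒≡1 i∣1) ⟩
  (p ∸ 1) * 1      ≡⟨ *-identityʳ _ ⟩
  p ∸ 1            ∎
  where open ≡-Reasoning

-- Binomial coefficients

binomial-sum : ∀ n → 1 + (∑[1≤ k ≤ n ] n C k) ≡ 2 ^ n
binomial-sum zero    = refl
binomial-sum (suc n) = begin
  1 + (∑[1≤ k ≤ suc n ] suc n C k)                  ≡⟨ cong (1 +_) (∑₁-cong (suc n) pascal) ⟩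
  1 + (∑[1≤ k ≤ suc n ] n C pred k + n C k)         ≡⟨ cong (1 +_) (∑₁-distrib-+ (suc n) _ _) ⟩
  1 + ((∑[1≤ k ≤ suc n ] n C pred k) + (s + n C suc n))
    ≡⟨ cong₂ (λ x y → 1 + (x + (s + y))) (∑₁-suc n _) (k>n⇒nCk≡0 (n<1+n n)) ⟩
  1 + ((1 + s) + (s + 0))                           ≡⟨ double s ⟩
  2 * (1 + s)                                       ≡⟨ cong (2 *_) (binomial-sum n) ⟩
  2 * 2 ^ n                                         ∎
  where
  open ≡-Reasoning
  s : ℕ
  s = ∑₁ n (n C_)
  pascal : ∀ {k} → 1 ≤ k → k ≤ suc n → suc n C k ≡ n C pred k + n C k
  pascal {suc k} _ _ = sym (nCk+nC[k+1]≡[n+1]C[k+1] n k)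
  double : ∀ s → 1 + ((1 + s) + (s + 0)) ≡ 2 * (1 + s)
  double = solve-∀

binomial-absorption : ∀ n k → suc k * (suc n C suc k) ≡ suc n * (n C k)
binomial-absorption zero    zero    = refl
binomial-absorption zero    (suc k) = *-zeroʳ (2 + k)
binomial-absorption (suc n) zero    =
  trans (*-identityˡ _) (trans (nC1≡n (2 + n)) (sym (*-identityʳ (2 + n))))
binomial-absorption (suc n) (suc k) = begin
  (2 + k) * ((2 + n) C (2 + k))            ≡⟨ cong ((2 + k) *_) (pascal (suc n) (suc k)) ⟨
  (2 + k) * (X + suc n C (2 + k))          ≡⟨ regroup k X _ ⟩
  suc k * X + X + (2 + k) * (suc n C (2 + k))
    ≡⟨ cong₂ (λ x y → x + X + y) (binomial-absorption n k) (binomial-absorption n (suc k)) ⟩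
  suc n * a + X + suc n * b                ≡⟨ cong (λ x → suc n * a + x + suc n * b) (pascal n k) ⟨
  suc n * a + (a + b) + suc n * b          ≡⟨ collect n a b ⟩
  (2 + n) * (a + b)                        ≡⟨ cong ((2 + n) *_) (pascal n k) ⟩
  (2 + n) * X                              ∎
  where
  open ≡-Reasoning
  pascal : ∀ n k → n C k + n C suc k ≡ suc n C suc k
  pascal = nCk+nC[k+1]≡[n+1]C[k+1]
  a b X : ℕ
  a = n C k
  b = n C suc k
  X = suc n C suc k
  regroup : ∀ k x y → (2 + k) * (x + y) ≡ suc k * x + x + (2 + k) * y
  regroup = solve-∀
  collect : ∀ n a b → suc n * a + (a + b) + suc n * b ≡ (2 + n) * (a + b)
  collect = solve-∀

prime∣binomial : ∀ {p k} → Prime p → 1 ≤ k → k < p → p ∣ p C k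
prime∣binomial {suc n} {suc k} p-prime _ k<p = coprime-divisor (prime⇒coprime p-prime k<p)
  (divides (n C k) (trans (binomial-absorption n k) (*-comm (suc n) (n C k))))

-- The multiplicative order of 2

infix 4 2^_≡1[mod_]
2^_≡1[mod_] : ℕ → ℕ → Set
2^ r ≡1[mod d ] = d ∣ 2 ^ r ∸ 1

m*n∸1≡m*[n∸1]+[m∸1] : ∀ m n .{{_ : NonZero m}} .{{_ : NonZero n}} →
                      m * n ∸ 1 ≡ m * (n ∸ 1) + (m ∸ 1)
m*n∸1≡m*[n∸1]+[m∸1] (suc a) (suc b) = regroup a b
  where
  regroup : ∀ a b → b + a * suc b ≡ suc a * b + a
  regroup = solve-∀

2^[m+n]∸1≡2^m*[2^n∸1]+[2^m∸1] : ∀ m n →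
                                2 ^ (m + n) ∸ 1 ≡ 2 ^ m * (2 ^ n ∸ 1) + (2 ^ m ∸ 1)
2^[m+n]∸1≡2^m*[2^n∸1]+[2^m∸1] m n = trans (cong (_∸ 1) (^-distribˡ-+-* 2 m n))
  (m*n∸1≡m*[n∸1]+[m∸1] (2 ^ m) (2 ^ n) {{m^n≢0 2 m}} {{m^n≢0 2 n}})

module _ {d : ℕ} where

  ≡1[mod]-+ : ∀ {m n} → 2^ m ≡1[mod d ] → 2^ n ≡1[mod d ] → 2^ m + n ≡1[mod d ]
  ≡1[mod]-+ {m} {n} d∣2^m∸1 d∣2^n∸1 = subst (d ∣_) (sym (2^[m+n]∸1≡2^m*[2^n∸1]+[2^m∸1] m n))
    (∣m∣n⇒∣m+n (∣n⇒∣m*n (2 ^ m) d∣2^n∸1) d∣2^m∸1)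

  ≡1[mod]-* : ∀ c {n} → 2^ n ≡1[mod d ] → 2^ c * n ≡1[mod d ]
  ≡1[mod]-* zero        _       = d ∣0
  ≡1[mod]-* (suc c) {n} d∣2^n∸1 = ≡1[mod]-+ {n} {c * n} d∣2^n∸1 (≡1[mod]-* c d∣2^n∸1)

  ≡1[mod]-cancelˡ : Coprime d 2 → ∀ {m n} →
                    2^ m ≡1[mod d ] → 2^ m + n ≡1[mod d ] → 2^ n ≡1[mod d ]
  ≡1[mod]-cancelˡ d⊥2 {m} {n} d∣2^m∸1 d∣2^[m+n]∸1 = coprime-divisor (coprime-^ʳ m d⊥2)
    (∣m+n∣m⇒∣n (subst (d ∣_) expand d∣2^[m+n]∸1) d∣2^m∸1)
    where
    expand : 2 ^ (m + n) ∸ 1 ≡ (2 ^ m ∸ 1) + 2 ^ m * (2 ^ n ∸ 1)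
    expand = trans (2^[m+n]∸1≡2^m*[2^n∸1]+[2^m∸1] m n) (+-comm _ (2 ^ m ∸ 1))

  ≡1[mod]-% : Coprime d 2 → ∀ {r n} .{{_ : NonZero n}} →
              2^ r ≡1[mod d ] → 2^ n ≡1[mod d ] → 2^ r % n ≡1[mod d ]
  ≡1[mod]-% d⊥2 {r} {n} d∣2^r∸1 d∣2^n∸1 =
    ≡1[mod]-cancelˡ d⊥2 {r / n * n} {r % n} (≡1[mod]-* (r / n) d∣2^n∸1)
      (subst (λ t → 2^ t ≡1[mod d ]) (trans (m≡m%n+[m/n]*n r n) (+-comm (r % n) _)) d∣2^r∸1)

%≡%⇒∣∸ : ∀ x y d .{{_ : NonZero d}} → x % d ≡ y % d → d ∣ y ∸ x
%≡%⇒∣∸ x y d x%d≡y%d = divides (y / d ∸ x / d) (begin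
  y ∸ x                                      ≡⟨ cong₂ _∸_ (m≡m%n+[m/n]*n y d) (m≡m%n+[m/n]*n x d) ⟩
  (y % d + y / d * d) ∸ (x % d + x / d * d)  ≡⟨ cong (λ t → y % d + y / d * d ∸ (t + x / d * d)) x%d≡y%d ⟩
  (y % d + y / d * d) ∸ (y % d + x / d * d)  ≡⟨ [m+n]∸[m+o]≡n∸o (y % d) _ _ ⟩
  y / d * d ∸ x / d * d                      ≡⟨ *-distribʳ-∸ d (y / d) (x / d) ⟨
  (y / d ∸ x / d) * d                        ∎)
  where open ≡-Reasoning

≡1[mod]-exists : ∀ {d} .{{_ : NonZero d}} → Coprime d 2 → ∃[ r ] 1 ≤ r × r ≤ d × 2^ r ≡1[mod d ]
≡1[mod]-exists {d} d⊥2 with pigeonhole (n<1+n d) (λ i → fromℕ< (m%n<n (2 ^ toℕ i) d))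
... | i , j , i<j , same =
  r , m<n⇒0<n∸m i<j , ≤-trans (m∸n≤m b a) (s≤s⁻¹ (toℕ<n j)) , d∣2^r∸1
  where
  open ≡-Reasoning
  a b r : ℕ
  a = toℕ i
  b = toℕ j
  r = b ∸ a
  same-residue : 2 ^ a % d ≡ 2 ^ b % d
  same-residue = trans (sym (toℕ-fromℕ< _)) (trans (cong toℕ same) (toℕ-fromℕ< _))
  2^b∸2^a≡2^a*[2^r∸1] : 2 ^ b ∸ 2 ^ a ≡ 2 ^ a * (2 ^ r ∸ 1)
  2^b∸2^a≡2^a*[2^r∸1] = begin
    2 ^ b ∸ 2 ^ a              ≡⟨ cong (λ t → 2 ^ t ∸ 2 ^ a) (m+[n∸m]≡n (<⇒≤ i<j)) ⟨
    2 ^ (a + r) ∸ 2 ^ a        ≡⟨ cong₂ _∸_ (^-distribˡ-+-* 2 a r) (sym (*-identityʳ (2 ^ a))) ⟩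
    2 ^ a * 2 ^ r ∸ 2 ^ a * 1  ≡⟨ *-distribˡ-∸ (2 ^ a) (2 ^ r) 1 ⟨
    2 ^ a * (2 ^ r ∸ 1)        ∎
  d∣2^r∸1 : 2^ r ≡1[mod d ]
  d∣2^r∸1 = coprime-divisor (coprime-^ʳ a d⊥2)
    (subst (d ∣_) 2^b∸2^a≡2^a*[2^r∸1] (%≡%⇒∣∸ _ _ d same-residue))

search-least : ∀ d lo fuel {r} → lo ≤ r → r < search d lo fuel → ¬ 2^ r ≡1[mod d ]
search-least d lo (suc fuel) {r} lo≤r r<s with d ∣? (2 ^ lo ∸ 1)
... | yes _        = ⊥-elim (<⇒≱ r<s lo≤r)
... | no  d∤2^lo∸1 with m≤n⇒m<n∨m≡n lo≤r
...   | inj₁ lo<r  = search-least d (suc lo) fuel lo<r r<s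
...   | inj₂ refl  = d∤2^lo∸1

search-found : ∀ d lo fuel {r} → lo ≤ r → r < lo + fuel → 2^ r ≡1[mod d ] →
               lo ≤ search d lo fuel × 2^ search d lo fuel ≡1[mod d ]
search-found d lo zero       {r} lo≤r r<lo+0 _ =
  ⊥-elim (<⇒≱ (subst (r <_) (+-identityʳ lo) r<lo+0) lo≤r)
search-found d lo (suc fuel) {r} lo≤r r<lo+1+fuel d∣2^r∸1 with d ∣? (2 ^ lo ∸ 1)
... | yes d∣2^lo∸1 = ≤-refl , d∣2^lo∸1
... | no  d∤2^lo∸1 with m≤n⇒m<n∨m≡n lo≤r
...   | inj₁ lo<r  = map₁ (≤-trans (n≤1+n lo)) (search-found d (suc lo) fuel lo<r r<suc-lo+fuel d∣2^r∸1)
  where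
  r<suc-lo+fuel : r < suc lo + fuel
  r<suc-lo+fuel = subst (r <_) (+-suc lo fuel) r<lo+1+fuel
...   | inj₂ refl  = ⊥-elim (d∤2^lo∸1 d∣2^r∸1)

module _ {d} .{{_ : NonZero d}} (d⊥2 : Coprime d 2) where

  private
    ord₂-spec : 1 ≤ ord₂ d × 2^ ord₂ d ≡1[mod d ]
    ord₂-spec with ≡1[mod]-exists d⊥2
    ... | r , 1≤r , r≤d , d∣2^r∸1 = search-found d 1 d 1≤r (s≤s r≤d) d∣2^r∸1

  instance
    ord₂≢0 : NonZero (ord₂ d)
    ord₂≢0 = >-nonZero (proj₁ ord₂-spec)

  2^ord₂≡1 : 2^ ord₂ d ≡1[mod d ]
  2^ord₂≡1 = proj₂ ord₂-spec

  ord₂∣⇒≡1 : ∀ {r} → ord₂ d ∣ r → 2^ r ≡1[mod d ]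
  ord₂∣⇒≡1 (divides q refl) = ≡1[mod]-* q 2^ord₂≡1

  ≡1⇒ord₂∣ : ∀ {r} → 2^ r ≡1[mod d ] → ord₂ d ∣ r
  ≡1⇒ord₂∣ {r} d∣2^r∸1 with r % ord₂ d in r%o≡ | ≡1[mod]-% d⊥2 {r} {ord₂ d} d∣2^r∸1 2^ord₂≡1
  ... | zero  | _ = m%n≡0⇒n∣m r (ord₂ d) r%o≡
  ... | suc s | d∣2^[1+s]∸1 =
    ⊥-elim (search-least d 1 d (s≤s z≤n) (subst (_< ord₂ d) r%o≡ (m%n<n r (ord₂ d))) d∣2^[1+s]∸1)

ord₂[a*b]≡lcm : ∀ {a b} .{{_ : NonZero a}} .{{_ : NonZero b}} →
                Coprime a b → Coprime a 2 → Coprime b 2 → ord₂ (a * b) ≡ lcm (ord₂ a) (ord₂ b)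
ord₂[a*b]≡lcm {a} {b} a⊥b a⊥2 b⊥2 = ∣-antisym
  (≡1⇒ord₂∣ ab⊥2 (∣×∣⇒*∣ a⊥b (ord₂∣⇒≡1 a⊥2 (m∣lcm[m,n] _ (ord₂ b)))
                             (ord₂∣⇒≡1 b⊥2 (n∣lcm[m,n] (ord₂ a) _))))
  (lcm-least (≡1⇒ord₂∣ a⊥2 (∣-trans (m∣m*n b) (2^ord₂≡1 ab⊥2)))
             (≡1⇒ord₂∣ b⊥2 (∣-trans (n∣m*n a) (2^ord₂≡1 ab⊥2))))
  where
  instance
    ab≢0 : NonZero (a * b)
    ab≢0 = m*n≢0 a b
  ab⊥2 : Coprime (a * b) 2
  ab⊥2 = coprime-*ˡ a⊥2 b⊥2

-- By the binomial theorem 2 ^ p = 2 + X, where X is the sum of the inner binomial coefficients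
-- of row p, each of which p divides.
fermat : ∀ {p} → Prime p → Coprime p 2 → 2^ (p ∸ 1) ≡1[mod p ]
fermat {suc n} p-prime p⊥2 = coprime-divisor p⊥2 (subst (suc n ∣_) X≡2*[2^n∸1] p∣X)
  where
  open ≡-Reasoning
  X : ℕ
  X = ∑₁ n (suc n C_)
  p∣X : suc n ∣ X
  p∣X = ∣-∑₁ n (λ 1≤k k≤n → prime∣binomial p-prime 1≤k (s≤s k≤n))
  X≡2*[2^n∸1] : X ≡ 2 * (2 ^ n ∸ 1)
  X≡2*[2^n∸1] = begin
    X                              ≡⟨ m+n∸m≡n 2 X ⟨
    2 + X ∸ 2                      ≡⟨ cong (λ t → 1 + t ∸ 2) (+-comm 1 X) ⟩
    1 + (X + 1) ∸ 2                ≡⟨ cong (λ t → 1 + (X + t) ∸ 2) (nCn≡1 (suc n)) ⟨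
    1 + ∑₁ (suc n) (suc n C_) ∸ 2  ≡⟨ cong (_∸ 2) (binomial-sum (suc n)) ⟩
    2 * 2 ^ n ∸ 2 * 1              ≡⟨ *-distribˡ-∸ 2 (2 ^ n) 1 ⟨
    2 * (2 ^ n ∸ 1)                ∎

-- The ratio r₂ at primes and their multiples

÷≡/ : ∀ a n .{{_ : NonZero n}} → a ÷ n ≡ a / n
÷≡/ a (suc n) = refl

gcd[gcd[k,m],n]≡gcd[k,n] : ∀ k {m n} → n ∣ m → gcd (gcd k m) n ≡ gcd k n
gcd[gcd[k,m],n]≡gcd[k,n] k {m} {n} n∣m =
  trans (gcd-assoc k m n) (cong (gcd k) (∣-antisym (gcd[m,n]∣n m n) (gcd-greatest n∣m ∣-refl)))

n*a÷lcm[a,b]≡n*gcd[a,b]÷b : ∀ n a b .{{_ : NonZero a}} .{{_ : NonZero b}} →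
                            (n * a) ÷ lcm a b ≡ (n * gcd a b) ÷ b
n*a÷lcm[a,b]≡n*gcd[a,b]÷b n a b = begin
  (n * a) ÷ L              ≡⟨ ÷≡/ (n * a) L ⟩
  (n * a) / L              ≡⟨ m*n/m*o≡n/o g (n * a) L ⟨
  (g * (n * a)) / (g * L)  ≡⟨ /-congˡ {o = g * L} (regroup g n a) ⟩
  (a * (n * g)) / (g * L)  ≡⟨ /-congʳ (gcd*lcm a b) ⟩
  (a * (n * g)) / (a * b)  ≡⟨ m*n/m*o≡n/o a (n * g) b ⟩
  (n * g) / b              ≡⟨ ÷≡/ (n * g) b ⟨
  (n * g) ÷ b              ∎
  where
  open ≡-Reasoning
  g L : ℕ
  g = gcd a b
  L = lcm a b
  instance
    ab≢0 : NonZero (a * b)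
    ab≢0 = m*n≢0 a b
    gL≢0 : NonZero (g * L)
    gL≢0 = subst NonZero (sym (gcd*lcm a b)) ab≢0
    g≢0 : NonZero g
    g≢0 = m*n≢0⇒m≢0 g
    L≢0 : NonZero L
    L≢0 = m*n≢0⇒n≢0 g
  regroup : ∀ g n a → g * (n * a) ≡ a * (n * g)
  regroup = solve-∀

module _ {p} (p-prime : Prime p) (p⊥2 : Coprime p 2) where

  private instance
    p≢0 : NonZero p
    p≢0 = prime⇒nonZero p-prime
    ord₂p≢0 : NonZero (ord₂ p)
    ord₂p≢0 = ord₂≢0 p⊥2

  p∸1≡r₂*ord₂ : p ∸ 1 ≡ r₂ p * ord₂ p
  p∸1≡r₂*ord₂ = begin
    p ∸ 1                      ≡⟨ m/n*n≡m (≡1⇒ord₂∣ p⊥2 (fermat p-prime p⊥2)) ⟨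
    (p ∸ 1) / ord₂ p * ord₂ p  ≡⟨ cong (_* ord₂ p) (÷≡/ (p ∸ 1) (ord₂ p)) ⟨
    (p ∸ 1) ÷ ord₂ p * ord₂ p  ≡⟨ cong (λ t → t ÷ ord₂ p * ord₂ p) (φ-prime p-prime) ⟨
    r₂ p * ord₂ p              ∎
    where open ≡-Reasoning

  p∸1÷r₂≡ord₂ : (p ∸ 1) ÷ r₂ p ≡ ord₂ p
  p∸1÷r₂≡ord₂ = begin
    (p ∸ 1) ÷ r₂ p        ≡⟨ ÷≡/ (p ∸ 1) (r₂ p) ⟩
    (p ∸ 1) / r₂ p        ≡⟨ /-congˡ (trans p∸1≡r₂*ord₂ (*-comm (r₂ p) (ord₂ p))) ⟩
    ord₂ p * r₂ p / r₂ p  ≡⟨ m*n/n≡m (ord₂ p) (r₂ p) ⟩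
    ord₂ p                ∎
    where
    open ≡-Reasoning
    p∸1≢0 : NonZero (p ∸ 1)
    p∸1≢0 = >-nonZero (m<n⇒0<n∸m (nonTrivial⇒n>1 p {{prime⇒nonTrivial p-prime}}))
    instance
      r₂p≢0 : NonZero (r₂ p)
      r₂p≢0 = m*n≢0⇒m≢0 (r₂ p) {{subst NonZero p∸1≡r₂*ord₂ p∸1≢0}}

  r₂-*-prime : ∀ {j} .{{_ : NonZero j}} → Coprime j 2 → Coprime p j →
               r₂ (p * j) ≡ (r₂ p * φ j * gcd (ord₂ p) (ord₂ j)) ÷ ord₂ j
  r₂-*-prime {j} j⊥2 p⊥j = begin
    φ (p * j) ÷ ord₂ (p * j)
      ≡⟨ cong₂ _÷_ (φ-*-prime p-prime p⊥j) (ord₂[a*b]≡lcm p⊥j p⊥2 j⊥2) ⟩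
    ((p ∸ 1) * φ j) ÷ lcm (ord₂ p) (ord₂ j)
      ≡⟨ cong (λ t → (t * φ j) ÷ lcm (ord₂ p) (ord₂ j)) p∸1≡r₂*ord₂ ⟩
    (r₂ p * ord₂ p * φ j) ÷ lcm (ord₂ p) (ord₂ j)
      ≡⟨ cong (_÷ lcm (ord₂ p) (ord₂ j)) (xy∙z≈xz∙y *-commutativeSemigroup (r₂ p) (ord₂ p) (φ j)) ⟩
    (r₂ p * φ j * ord₂ p) ÷ lcm (ord₂ p) (ord₂ j)
      ≡⟨ n*a÷lcm[a,b]≡n*gcd[a,b]÷b (r₂ p * φ j) (ord₂ p) (ord₂ j) {{ord₂p≢0}} {{ord₂≢0 j⊥2}} ⟩
    (r₂ p * φ j * gcd (ord₂ p) (ord₂ j)) ÷ ord₂ j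
      ∎
    where open ≡-Reasoning

-- Divisor sums over p * m

module _ {p m} (p-prime : Prime p) (p∤m : ¬ p ∣ m) where

  private instance
    p≢0 : NonZero p
    p≢0 = prime⇒nonZero p-prime

  -- Since p ∤ m, a divisor of p * m divides m or is a multiple of p, and never both.
  𝟙[∣p*m] : ∀ k → 𝟙[ k ∣? p * m ] ≡ 𝟙[ k ∣? m ] + 𝟙[ p ∣? k ] * 𝟙[ k ∣? p * m ]
  𝟙[∣p*m] k with k ∣? m | p ∣? k | k ∣? p * m
  ... | yes k∣m | yes p∣k | _        = ⊥-elim (p∤m (∣-trans p∣k k∣m))
  ... | yes _   | no  _   | yes _    = refl
  ... | yes k∣m | no  _   | no  k∤pm = ⊥-elim (k∤pm (∣n⇒∣m*n p k∣m))
  ... | no  _   | yes _   | yes _    = refl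
  ... | no  _   | yes _   | no  _    = refl
  ... | no  k∤m | no  p∤k | yes k∣pm =
    ⊥-elim (k∤m (coprime-divisor (Coprime.sym (prime∤⇒coprime p-prime p∤k)) k∣pm))
  ... | no  _   | no  _   | no  _    = refl

  sum-divisors-*-prime : .{{_ : NonZero m}} → ∀ (f : ℕ → ℕ) →
    sum (map f (divisors (p * m))) ≡ sum (map f (divisors m)) + sum (map (f ∘ (p *_)) (divisors m))
  sum-divisors-*-prime f = begin
    sum (map f (divisors (p * m)))
      ≡⟨ sum-map-divisors f (p * m) ⟩
    (∑[1≤ k ≤ p * m ] 𝟙[ k ∣? p * m ] * f k)
      ≡⟨ ∑₁-cong (p * m) (λ _ _ → split _) ⟩
    (∑[1≤ k ≤ p * m ] 𝟙[ k ∣? m ] * f k + 𝟙[ p ∣? k ] * g k)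
      ≡⟨ ∑₁-distrib-+ (p * m) _ _ ⟩
    (∑[1≤ k ≤ p * m ] 𝟙[ k ∣? m ] * f k) + (∑[1≤ k ≤ p * m ] 𝟙[ p ∣? k ] * g k)
      ≡⟨ cong₂ _+_ divisorsOfM (∑₁-multiples p g m) ⟩
    (∑[1≤ k ≤ m ] 𝟙[ k ∣? m ] * f k) + (∑[1≤ j ≤ m ] g (p * j))
      ≡⟨ cong (_ +_) (∑₁-cong m (λ _ _ → g[p*j] _)) ⟩
    (∑[1≤ k ≤ m ] 𝟙[ k ∣? m ] * f k) + (∑[1≤ j ≤ m ] 𝟙[ j ∣? m ] * f (p * j))
      ≡⟨ cong₂ _+_ (sum-map-divisors f m) (sum-map-divisors (f ∘ (p *_)) m) ⟨
    sum (map f (divisors m)) + sum (map (f ∘ (p *_)) (divisors m))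
      ∎
    where
    open ≡-Reasoning
    g : ℕ → ℕ
    g k = 𝟙[ k ∣? p * m ] * f k
    split : ∀ k → 𝟙[ k ∣? p * m ] * f k ≡ 𝟙[ k ∣? m ] * f k + 𝟙[ p ∣? k ] * g k
    split k = begin
      𝟙[ k ∣? p * m ] * f k
        ≡⟨ cong (_* f k) (𝟙[∣p*m] k) ⟩
      (𝟙[ k ∣? m ] + 𝟙[ p ∣? k ] * 𝟙[ k ∣? p * m ]) * f k
        ≡⟨ *-distribʳ-+ (f k) 𝟙[ k ∣? m ] _ ⟩
      𝟙[ k ∣? m ] * f k + 𝟙[ p ∣? k ] * 𝟙[ k ∣? p * m ] * f k
        ≡⟨ cong (𝟙[ k ∣? m ] * f k +_) (*-assoc 𝟙[ p ∣? k ] _ (f k)) ⟩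
      𝟙[ k ∣? m ] * f k + 𝟙[ p ∣? k ] * g k
        ∎
    divisorsOfM : (∑[1≤ k ≤ p * m ] 𝟙[ k ∣? m ] * f k) ≡ (∑[1≤ k ≤ m ] 𝟙[ k ∣? m ] * f k)
    divisorsOfM = ∑₁-tail _ (m≤n*m m p) (λ {k} m<k → cong (_* f k) (𝟙-no (k ∣? m) (>⇒∤ m<k)))
    g[p*j] : ∀ j → g (p * j) ≡ 𝟙[ j ∣? m ] * f (p * j)
    g[p*j] j = cong (_* f (p * j)) (𝟙-cong (*-cancelˡ-∣ p) (*-monoʳ-∣ p) (p * j ∣? p * m) (j ∣? m))

-- The value of i₂ (p * m) in terms of r = r₂ p and g = gcd (ord₂ p) (ord₂ m).
i₂-prime-multiple : ℕ → ℕ → ℕ → ℕ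
i₂-prime-multiple m r g = i₂ m + sum (map (λ j → (r * φ j * gcd g (ord₂ j)) ÷ ord₂ j) (divisors m))

i₂-*-prime : ∀ {p m} .{{_ : NonZero m}} → Prime p → Coprime p 2 → Coprime m 2 → Coprime p m →
             i₂ (p * m) ≡ i₂-prime-multiple m (r₂ p) (gcd (ord₂ p) (ord₂ m))
i₂-*-prime {p} {m} p-prime p⊥2 m⊥2 p⊥m =
  trans (sum-divisors-*-prime p-prime p∤m r₂) (cong (i₂ m +_) (sum-map-divisors-cong m r₂[p*j]))
  where
  p∤m : ¬ p ∣ m
  p∤m p∣m = <⇒≢ (nonTrivial⇒n>1 p {{prime⇒nonTrivial p-prime}}) (sym (p⊥m (∣-refl , p∣m)))
  r₂[p*j] : ∀ {j} → j ∣ m → r₂ (p * j) ≡ (r₂ p * φ j * gcd (gcd (ord₂ p) (ord₂ m)) (ord₂ j)) ÷ ord₂ j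
  r₂[p*j] {j} j∣m = begin
    r₂ (p * j)
      ≡⟨ r₂-*-prime p-prime p⊥2 j⊥2 (coprime-∣ʳ p⊥m j∣m) ⟩
    (r₂ p * φ j * gcd (ord₂ p) (ord₂ j)) ÷ ord₂ j
      ≡⟨ cong (λ g → (r₂ p * φ j * g) ÷ ord₂ j) (gcd[gcd[k,m],n]≡gcd[k,n] (ord₂ p) ord₂j∣ord₂m) ⟨
    (r₂ p * φ j * gcd (gcd (ord₂ p) (ord₂ m)) (ord₂ j)) ÷ ord₂ j
      ∎
    where
    open ≡-Reasoning
    instance
      j≢0 : NonZero j
      j≢0 = divisor-nonZero j∣m
    j⊥2 : Coprime j 2
    j⊥2 = coprime-∣ˡ m⊥2 j∣m
    ord₂j∣ord₂m : ord₂ j ∣ ord₂ m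
    ord₂j∣ord₂m = ≡1⇒ord₂∣ j⊥2 (∣-trans j∣m (2^ord₂≡1 m⊥2))

i₂-*-odd-prime : ∀ {p m} .{{_ : NonZero m}} → Prime p → ¬ 2 ∣ p → Coprime m 2 → Coprime p m →
                 i₂ (p * m) ≡ i₂-prime-multiple m (r₂ p) (gcd ((p ∸ 1) ÷ r₂ p) (ord₂ m))
i₂-*-odd-prime {p} {m} p-prime 2∤p m⊥2 p⊥m = begin
  i₂ (p * m)
    ≡⟨ i₂-*-prime p-prime p⊥2 m⊥2 p⊥m ⟩
  i₂-prime-multiple m (r₂ p) (gcd (ord₂ p) (ord₂ m))
    ≡⟨ cong (λ o → i₂-prime-multiple m (r₂ p) (gcd o (ord₂ m))) (p∸1÷r₂≡ord₂ p-prime p⊥2) ⟨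
  i₂-prime-multiple m (r₂ p) (gcd ((p ∸ 1) ÷ r₂ p) (ord₂ m))
    ∎
  where
  open ≡-Reasoning
  p⊥2 : Coprime p 2
  p⊥2 = Coprime.sym (prime∤⇒coprime prime[2] 2∤p)

proposition6 : (p q m : ℕ) → Prime p → ¬ (2 ∣ p) → Prime q → ¬ (2 ∣ q) →
    gcd m (2 * p * q) ≡ 1 →
    r₂ p ≡ r₂ q →
    gcd ((p ∸ 1) ÷ r₂ p) (ord₂ m) ≡ gcd ((q ∸ 1) ÷ r₂ q) (ord₂ m) →
    i₂ (p * m) ≡ i₂ (q * m)
proposition6 p q zero _ _ _ _ gcd[m,2pq]≡1 _ _ =
  contradiction (gcd≡1⇒coprime gcd[m,2pq]≡1 (2 ∣0 , ∣-trans (m∣m*n p) (m∣m*n q))) λ ()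
proposition6 p q m@(suc _) p-prime 2∤p q-prime 2∤q gcd[m,2pq]≡1 r₂p≡r₂q gcd≡gcd = begin
  i₂ (p * m)                                                  ≡⟨ i₂-*-odd-prime p-prime 2∤p m⊥2 p⊥m ⟩
  i₂-prime-multiple m (r₂ p) (gcd ((p ∸ 1) ÷ r₂ p) (ord₂ m))  ≡⟨ cong₂ (i₂-prime-multiple m) r₂p≡r₂q gcd≡gcd ⟩
  i₂-prime-multiple m (r₂ q) (gcd ((q ∸ 1) ÷ r₂ q) (ord₂ m))  ≡⟨ i₂-*-odd-prime q-prime 2∤q m⊥2 q⊥m ⟨
  i₂ (q * m)                                                  ∎
  where
  open ≡-Reasoning
  m⊥2pq : Coprime m (2 * p * q)
  m⊥2pq = gcd≡1⇒coprime gcd[m,2pq]≡1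
  m⊥2 : Coprime m 2
  m⊥2 = coprime-∣ʳ m⊥2pq (∣-trans (m∣m*n p) (m∣m*n q))
  p⊥m : Coprime p m
  p⊥m = Coprime.sym (coprime-∣ʳ m⊥2pq (∣-trans (n∣m*n 2) (m∣m*n q)))
  q⊥m : Coprime q m
  q⊥m = Coprime.sym (coprime-∣ʳ m⊥2pq (n∣m*n (2 * p)))
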